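{- Let $\chi$ be a Dirichlet character of conductor $f$. For any integers $N\ge 1$ and $n\ge 0$, \[ B_{N,n,\chi}=\sum_{a=1}^f\chi(a)\sum_{k=0}^n\binom{n}{k}B_{N,k}\,a^{n-k}f^{k-N}. \]
   Context: For an integer $N\ge 1$ and a Dirichlet character $\chi$ of conductor $f$, the generalized hypergeometric Bernoulli numbers $B_{N,n,\chi}$ are defined by $\sum_{a=1}^f \frac{\chi(a)\, t^N e^{at}/N!}{e^{ft}-\sum_{m=0}^{N-1}\frac{(ft)^m}{m!}}=\sum_{n=0}^\infty B_{N,n,\chi}\frac{t^n}{n!}$ for $|t|<2\pi/f$. The hypergeometric Bernoulli numbers $B_{N,n}$ are defined by $\frac{t^N/N!}{e^t-\sum_{m=0}^{N-1}t^m/m!}=\sum_{n=0}^\infty B_{N,n}\frac{t^n}{n!}$. -}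

module Defs where

open import Level using (_⊔_)
open import Algebra.Bundles using (CommutativeRing)
open import Data.Nat as ℕ using (ℕ; zero; suc; _≤_; _<_; _!)
open import Data.Nat.Combinatorics using (_C_)
open import Data.Nat.Divisibility as ℕD using ()
open import Data.Nat.Coprimality using (Coprime)
open import Data.Integer as ℤ using (ℤ; +_; ∣_∣)
open import Data.Integer.Divisibility as ℤD using ()
open import Relation.Binary.PropositionalEquality using (_≡_; _≢_)
open import Relation.Nullary using (¬_)
open import Data.Bool using (if_then_else_)
open import Relation.Nullary.Decidable using (does)

module _ {c ℓ} (K : CommutativeRing c ℓ) where
  open CommutativeRing K

  ι : ℕ → Carrier
  ι zero    = 0#
  ι (suc n) = 1# + ι n

  pow : Carrier → ℕ → Carrier
  pow x zero    = 1#
  pow x (suc n) = x * pow x n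

  sumTo : ℕ → (ℕ → Carrier) → Carrier
  sumTo zero    g = g 0
  sumTo (suc n) g = sumTo n g + g (suc n)

  sum1 : ℕ → (ℕ → Carrier) → Carrier
  sum1 zero    g = 0#
  sum1 (suc m) g = sum1 m g + g (suc m)

  record QAlgebra : Set (c ⊔ ℓ) where
    field
      inv         : ℕ → Carrier
      inv-correct : ∀ n → n ≢ 0 → ι n * inv n ≈ 1#

  FPS : Set c
  FPS = ℕ → Carrier

  _≈ₛ_ : FPS → FPS → Set ℓ
  F ≈ₛ G = ∀ n → F n ≈ G n

  _·ₛ_ : FPS → FPS → FPS
  (F ·ₛ G) n = sumTo n (λ k → F k * G (n ℕ.∸ k))

  sum1ₛ : ℕ → (ℕ → FPS) → FPS
  sum1ₛ m F n = sum1 m (λ a → F a n)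

  _∙ₛ_ : Carrier → FPS → FPS
  (x ∙ₛ F) n = x * F n

  module _ (Q : QAlgebra) where
    open QAlgebra Q

    egf : (ℕ → Carrier) → FPS
    egf b n = b n * inv (n !)

    monoFact : ℕ → FPS
    monoFact N n = if does (n ℕ.≟ N) then inv (N !) else 0#

    expₛ : Carrier → FPS
    expₛ x n = pow x n * inv (n !)

    expTrunc : ℕ → Carrier → FPS
    expTrunc N x n = if does (N ℕ.≤? n) then pow x n * inv (n !) else 0#

    IsHypBernoulli : ℕ → (ℕ → Carrier) → Set ℓ
    IsHypBernoulli N B = (egf B ·ₛ expTrunc N 1#) ≈ₛ monoFact N

    IsGenHypBernoulli : ℕ → (ℤ → Carrier) → ℕ → (ℕ → Carrier) → Set ℓ
    IsGenHypBernoulli N χ f Bχ =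
      (egf Bχ ·ₛ expTrunc N (ι f))
        ≈ₛ sum1ₛ f (λ a → χ (+ a) ∙ₛ (monoFact N ·ₛ expₛ (ι a)))

  record IsDirichletChar (χ : ℤ → Carrier) (m : ℕ) : Set (c ⊔ ℓ) where
    field
      one      : χ (+ 1) ≈ 1#
      mult     : ∀ a b → χ (a ℤ.* b) ≈ χ a * χ b
      periodic : ∀ a → χ (a ℤ.+ + m) ≈ χ a
      vanish   : ∀ a → ¬ Coprime ∣ a ∣ m → χ a ≈ 0#

  -- χ is a Dirichlet character of conductor f, i.e. a primitive character modulo f ≥ 1:
  -- f is the least modulus d ∣ f such that χ(a) = 1 whenever (a,f)=1 and a ≡ 1 (mod d).
  record HasConductor (χ : ℤ → Carrier) (f : ℕ) : Set (c ⊔ ℓ) where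
    field
      f-pos     : 1 ≤ f
      isChar    : IsDirichletChar χ f
      isPrimitive : ∀ d → d ℕD.∣ f →
                  (∀ a → Coprime ∣ a ∣ f → (+ d) ℤD.∣ (a ℤ.- + 1) → χ a ≈ 1#) →
                  d ≡ f

-- Write b(t) = Σ B_{N,n} tⁿ/n!, so that b(t)(eᵗ − Σ_{m<N} tᵐ/m!) = t^N/N!. Substituting ft gives
-- b(ft)·E(t) = f^N t^N/N!, where E(t) = e^{ft} − Σ_{m<N} (ft)ᵐ/m!. Hence the series
-- C(t) = Σ_a χ(a) f^{−N} b(ft) e^{at} satisfies C·E = Σ_a χ(a) t^N e^{at}/N!, the defining
-- equation of the generating series of the B_{N,n,χ}. The series E is not invertible (it starts
-- in degree N), but it is cancellable: multiplying X·E = Y·E by b(ft) turns it into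
-- X·t^N = Y·t^N. So the generating series of the B_{N,n,χ} is C, and reading off the n-th
-- coefficient of C, a product of two exponential series, gives the binomial sum.
module Submission where

open import Algebra.Bundles using (CommutativeRing)
open import Data.Nat using (ℕ; _≤_; _∸_; _^_)
open import Data.Nat.Combinatorics using (_C_)
open import Data.Integer using (ℤ; +_)

open import Data.Nat as ℕ using (zero; suc; _!; z≤n; s≤s)
import Data.Nat.Properties as ℕP
import Data.Nat.Combinatorics as ℕC
import Data.Nat.DivMod as ℕDM
open import Function using (_∘_)
open import Relation.Binary.Bundles using (Setoid)
open import Relation.Binary.PropositionalEquality as P using (_≡_; _≢_)
open import Relation.Nullary using (yes; no)
open import Relation.Nullary.Decidable using (does; dec-true; dec-false)
open import Data.Bool using (true; false; if_then_else_)
import Algebra.Properties.CommutativeSemigroup as CommutativeSemigroupProperties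
import Algebra.Solver.CommutativeMonoid as CommutativeMonoidSolver
import Relation.Binary.Reasoning.Setoid as ≈-Reasoning

import Defs as D
open D using (QAlgebra; IsHypBernoulli; IsGenHypBernoulli; HasConductor)

nCk*k!*[n∸k]!≡n! : ∀ {n k} → k ≤ n → (n C k) ℕ.* (k ! ℕ.* (n ∸ k) !) ≡ n !
nCk*k!*[n∸k]!≡n! {n} {k} k≤n =
  P.trans (P.cong (ℕ._* (k ! ℕ.* (n ∸ k) !)) (ℕC.nCk≡n!/k![n-k]! k≤n))
          (ℕDM.m/n*n≡m {{ℕP._!*_!≢0 k (n ∸ k)}} (ℕC.k![n∸k]!∣n! k≤n))

module PowerSeries {c ℓ} (K : CommutativeRing c ℓ) where
  open CommutativeRing K hiding (zero)
  module +-Properties = CommutativeSemigroupProperties +-commutativeSemigroup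
  module *-Properties = CommutativeSemigroupProperties *-commutativeSemigroup
  module *-Solver = CommutativeMonoidSolver *-commutativeMonoid

  ι : ℕ → Carrier
  ι = D.ι K

  pow : Carrier → ℕ → Carrier
  pow = D.pow K

  sumTo : ℕ → (ℕ → Carrier) → Carrier
  sumTo = D.sumTo K

  sum1 : ℕ → (ℕ → Carrier) → Carrier
  sum1 = D.sum1 K

  FPS : Set c
  FPS = D.FPS K

  infix  4 _≈ₛ_
  infixl 7 _·ₛ_
  infixr 8 _∙ₛ_

  _≈ₛ_ : FPS → FPS → Set ℓ
  _≈ₛ_ = D._≈ₛ_ K

  _·ₛ_ : FPS → FPS → FPS
  _·ₛ_ = D._·ₛ_ K

  _∙ₛ_ : Carrier → FPS → FPS
  _∙ₛ_ = D._∙ₛ_ K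

  sum1ₛ : ℕ → (ℕ → FPS) → FPS
  sum1ₛ = D.sum1ₛ K

  ι-+ : ∀ m n → ι (m ℕ.+ n) ≈ ι m + ι n
  ι-+ zero    n = sym (+-identityˡ _)
  ι-+ (suc m) n = trans (+-congˡ (ι-+ m n)) (sym (+-assoc _ _ _))

  ι-* : ∀ m n → ι (m ℕ.* n) ≈ ι m * ι n
  ι-* zero    n = sym (zeroˡ _)
  ι-* (suc m) n = begin
    ι (n ℕ.+ m ℕ.* n)      ≈⟨ ι-+ n (m ℕ.* n) ⟩
    ι n + ι (m ℕ.* n)      ≈⟨ +-cong (sym (*-identityˡ _)) (ι-* m n) ⟩
    1# * ι n + ι m * ι n   ≈⟨ distribʳ _ _ _ ⟨
    (1# + ι m) * ι n       ∎
    where open ≈-Reasoning setoid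

  pow-+ : ∀ x m n → pow x (m ℕ.+ n) ≈ pow x m * pow x n
  pow-+ x zero    n = sym (*-identityˡ _)
  pow-+ x (suc m) n = trans (*-congˡ (pow-+ x m n)) (sym (*-assoc _ _ _))

  pow-1# : ∀ n → pow 1# n ≈ 1#
  pow-1# zero    = refl
  pow-1# (suc n) = trans (*-identityˡ _) (pow-1# n)

  ι-^ : ∀ m n → ι (m ^ n) ≈ pow (ι m) n
  ι-^ m zero    = +-identityʳ 1#
  ι-^ m (suc n) = trans (ι-* m (m ^ n)) (*-congˡ (ι-^ m n))

  *-cancelʳ-invertible : ∀ {x y u v} → u * v ≈ 1# → x * u ≈ y * u → x ≈ y
  *-cancelʳ-invertible {x} {y} {u} {v} uv≈1 xu≈yu = begin
    x            ≈⟨ *-identityʳ x ⟨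
    x * 1#       ≈⟨ *-congˡ uv≈1 ⟨
    x * (u * v)  ≈⟨ *-assoc _ _ _ ⟨
    (x * u) * v  ≈⟨ *-congʳ xu≈yu ⟩
    (y * u) * v  ≈⟨ *-assoc _ _ _ ⟩
    y * (u * v)  ≈⟨ *-congˡ uv≈1 ⟩
    y * 1#       ≈⟨ *-identityʳ y ⟩
    y            ∎
    where open ≈-Reasoning setoid

  sumTo-cong : ∀ n {g h : ℕ → Carrier} → (∀ k → k ≤ n → g k ≈ h k) → sumTo n g ≈ sumTo n h
  sumTo-cong zero    g≈h = g≈h 0 z≤n
  sumTo-cong (suc n) g≈h =
    +-cong (sumTo-cong n (λ k k≤n → g≈h k (ℕP.m≤n⇒m≤1+n k≤n))) (g≈h (suc n) ℕP.≤-refl)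

  sumTo-zero : ∀ n {g : ℕ → Carrier} → (∀ k → k ≤ n → g k ≈ 0#) → sumTo n g ≈ 0#
  sumTo-zero zero    g≈0 = g≈0 0 z≤n
  sumTo-zero (suc n) g≈0 = trans
    (+-cong (sumTo-zero n (λ k k≤n → g≈0 k (ℕP.m≤n⇒m≤1+n k≤n))) (g≈0 (suc n) ℕP.≤-refl))
    (+-identityˡ 0#)

  sumTo-distrib-+ : ∀ n (g h : ℕ → Carrier) →
                    sumTo n (λ k → g k + h k) ≈ sumTo n g + sumTo n h
  sumTo-distrib-+ zero    g h = refl
  sumTo-distrib-+ (suc n) g h =
    trans (+-congʳ (sumTo-distrib-+ n g h)) (+-Properties.interchange _ _ _ _)

  *-distribˡ-sumTo : ∀ n x (g : ℕ → Carrier) → x * sumTo n g ≈ sumTo n (λ k → x * g k)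
  *-distribˡ-sumTo zero    x g = refl
  *-distribˡ-sumTo (suc n) x g = trans (distribˡ x _ _) (+-congʳ (*-distribˡ-sumTo n x g))

  *-distribʳ-sumTo : ∀ n x (g : ℕ → Carrier) → sumTo n g * x ≈ sumTo n (λ k → g k * x)
  *-distribʳ-sumTo zero    x g = refl
  *-distribʳ-sumTo (suc n) x g = trans (distribʳ x _ _) (+-congʳ (*-distribʳ-sumTo n x g))

  sumTo-head : ∀ n (g : ℕ → Carrier) → sumTo (suc n) g ≈ g 0 + sumTo n (g ∘ suc)
  sumTo-head zero    g = refl
  sumTo-head (suc n) g = trans (+-congʳ (sumTo-head n g)) (+-assoc _ _ _)

  sumTo-reverse : ∀ n (g : ℕ → Carrier) → sumTo n g ≈ sumTo n (λ k → g (n ∸ k))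
  sumTo-reverse zero    g = refl
  sumTo-reverse (suc n) g = begin
    sumTo n g + g (suc n)                  ≈⟨ +-comm _ _ ⟩
    g (suc n) + sumTo n g                  ≈⟨ +-congˡ (sumTo-reverse n g) ⟩
    g (suc n) + sumTo n (λ k → g (n ∸ k))  ≈⟨ sumTo-head n (λ k → g (suc n ∸ k)) ⟨
    sumTo (suc n) (λ k → g (suc n ∸ k))    ∎
    where open ≈-Reasoning setoid

  sumTo-single : ∀ n j {g : ℕ → Carrier} → j ≤ n → (∀ k → k ≤ n → k ≢ j → g k ≈ 0#) →
                 sumTo n g ≈ g j
  sumTo-single zero    .zero z≤n _ = refl
  sumTo-single (suc n) j j≤1+n others with j ℕ.≟ suc n
  ... | yes P.refl = trans
    (+-congʳ (sumTo-zero n (λ k k≤n → others k (ℕP.m≤n⇒m≤1+n k≤n) (ℕP.<⇒≢ (s≤s k≤n)))))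
    (+-identityˡ _)
  ... | no j≢1+n = trans
    (+-cong (sumTo-single n j (ℕP.≤-pred (ℕP.≤∧≢⇒< j≤1+n j≢1+n))
                          (λ k k≤n → others k (ℕP.m≤n⇒m≤1+n k≤n)))
            (others (suc n) ℕP.≤-refl (j≢1+n ∘ P.sym)))
    (+-identityʳ _)

  sumTo-triangle : ∀ n (a : ℕ → ℕ → Carrier) →
    sumTo n (λ k → sumTo k (λ j → a j k)) ≈ sumTo n (λ j → sumTo (n ∸ j) (λ i → a j (j ℕ.+ i)))
  sumTo-triangle zero    a = refl
  sumTo-triangle (suc n) a = begin
    sumTo n (λ k → sumTo k (λ j → a j k)) + sumTo (suc n) (λ j → a j (suc n))
      ≈⟨ +-congʳ (sumTo-triangle n a) ⟩
    rows + (sumTo n (λ j → a j (suc n)) + a (suc n) (suc n))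
      ≈⟨ +-assoc _ _ _ ⟨
    (rows + sumTo n (λ j → a j (suc n))) + a (suc n) (suc n)
      ≈⟨ +-congʳ (sumTo-distrib-+ n _ _) ⟨
    sumTo n (λ j → row j (n ∸ j) + a j (suc n)) + a (suc n) (suc n)
      ≈⟨ +-cong (sumTo-cong n extendRow) (reflexive lastRow) ⟩
    sumTo n (λ j → row j (suc n ∸ j)) + row (suc n) (n ∸ n)
      ∎
    where
    open ≈-Reasoning setoid

    row : ℕ → ℕ → Carrier
    row j m = sumTo m (λ i → a j (j ℕ.+ i))

    rows : Carrier
    rows = sumTo n (λ j → row j (n ∸ j))

    extendRow : ∀ j → j ≤ n → row j (n ∸ j) + a j (suc n) ≈ row j (suc n ∸ j)
    extendRow j j≤n = begin
      row j (n ∸ j) + a j (suc n)                   ≡⟨ P.cong (λ m → row j (n ∸ j) + a j m) j+[1+n∸j]≡1+n ⟨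
      row j (n ∸ j) + a j (j ℕ.+ suc (n ∸ j))       ≡⟨ P.cong (row j) (ℕP.+-∸-assoc 1 j≤n) ⟨
      row j (suc n ∸ j)                             ∎
      where
      j+[1+n∸j]≡1+n : j ℕ.+ suc (n ∸ j) ≡ suc n
      j+[1+n∸j]≡1+n = P.trans (ℕP.+-suc j (n ∸ j)) (P.cong suc (ℕP.m+[n∸m]≡n j≤n))

    lastRow : a (suc n) (suc n) ≡ row (suc n) (n ∸ n)
    lastRow = P.sym (P.trans (P.cong (row (suc n)) (ℕP.n∸n≡0 n))
                             (P.cong (a (suc n)) (ℕP.+-identityʳ (suc n))))

  sum1-cong : ∀ m {g h : ℕ → Carrier} → (∀ a → g a ≈ h a) → sum1 m g ≈ sum1 m h
  sum1-cong zero    g≈h = refl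
  sum1-cong (suc m) g≈h = +-cong (sum1-cong m g≈h) (g≈h (suc m))

  *-distribˡ-sum1 : ∀ m x (g : ℕ → Carrier) → x * sum1 m g ≈ sum1 m (λ a → x * g a)
  *-distribˡ-sum1 zero    x g = zeroʳ x
  *-distribˡ-sum1 (suc m) x g = trans (distribˡ x _ _) (+-congʳ (*-distribˡ-sum1 m x g))

  *-distribʳ-sum1 : ∀ m x (g : ℕ → Carrier) → sum1 m g * x ≈ sum1 m (λ a → g a * x)
  *-distribʳ-sum1 zero    x g = zeroˡ x
  *-distribʳ-sum1 (suc m) x g = trans (distribʳ x _ _) (+-congʳ (*-distribʳ-sum1 m x g))

  sumTo-sum1-comm : ∀ n m (g : ℕ → ℕ → Carrier) →
                    sumTo n (λ k → sum1 m (λ a → g a k)) ≈ sum1 m (λ a → sumTo n (g a))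
  sumTo-sum1-comm n zero    g = sumTo-zero n (λ _ _ → refl)
  sumTo-sum1-comm n (suc m) g =
    trans (sumTo-distrib-+ n _ _) (+-congʳ (sumTo-sum1-comm n m g))

  ≈ₛ-setoid : Setoid c ℓ
  ≈ₛ-setoid = record
    { Carrier       = FPS
    ; _≈_           = _≈ₛ_
    ; isEquivalence = record
      { refl  = λ _ → refl
      ; sym   = λ F≈G n → sym (F≈G n)
      ; trans = λ F≈G G≈H n → trans (F≈G n) (G≈H n)
      }
    }

  module ≈ₛ = Setoid ≈ₛ-setoid

  ·ₛ-cong : ∀ {F F′ G G′} → F ≈ₛ F′ → G ≈ₛ G′ → F ·ₛ G ≈ₛ F′ ·ₛ G′
  ·ₛ-cong F≈F′ G≈G′ n = sumTo-cong n (λ k _ → *-cong (F≈F′ k) (G≈G′ (n ∸ k)))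

  ∙ₛ-congˡ : ∀ x {F G} → F ≈ₛ G → x ∙ₛ F ≈ₛ x ∙ₛ G
  ∙ₛ-congˡ x F≈G n = *-congˡ (F≈G n)

  ∙ₛ-inverse : ∀ {x y} F → x * y ≈ 1# → x ∙ₛ (y ∙ₛ F) ≈ₛ F
  ∙ₛ-inverse F xy≈1 n = trans (sym (*-assoc _ _ _)) (trans (*-congʳ xy≈1) (*-identityˡ _))

  sum1ₛ-cong : ∀ m {F G : ℕ → FPS} → (∀ a → F a ≈ₛ G a) → sum1ₛ m F ≈ₛ sum1ₛ m G
  sum1ₛ-cong m F≈G n = sum1-cong m (λ a → F≈G a n)

  ·ₛ-comm : ∀ F G → F ·ₛ G ≈ₛ G ·ₛ F
  ·ₛ-comm F G n = trans (sumTo-reverse n _) (sumTo-cong n (λ k k≤n →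
    trans (*-comm _ _) (*-congʳ (reflexive (P.cong G (ℕP.m∸[m∸n]≡n k≤n))))))

  ·ₛ-assoc : ∀ F G H → (F ·ₛ G) ·ₛ H ≈ₛ F ·ₛ (G ·ₛ H)
  ·ₛ-assoc F G H n = begin
    sumTo n (λ k → sumTo k (λ j → F j * G (k ∸ j)) * H (n ∸ k))
      ≈⟨ sumTo-cong n (λ k _ → *-distribʳ-sumTo k (H (n ∸ k)) _) ⟩
    sumTo n (λ k → sumTo k (λ j → F j * G (k ∸ j) * H (n ∸ k)))
      ≈⟨ sumTo-triangle n (λ j k → F j * G (k ∸ j) * H (n ∸ k)) ⟩
    sumTo n (λ j → sumTo (n ∸ j) (λ i → F j * G (j ℕ.+ i ∸ j) * H (n ∸ (j ℕ.+ i))))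
      ≈⟨ sumTo-cong n (λ j _ → sumTo-cong (n ∸ j) (λ i _ → reindex j i)) ⟩
    sumTo n (λ j → sumTo (n ∸ j) (λ i → F j * (G i * H (n ∸ j ∸ i))))
      ≈⟨ sumTo-cong n (λ j _ → *-distribˡ-sumTo (n ∸ j) (F j) _) ⟨
    sumTo n (λ j → F j * sumTo (n ∸ j) (λ i → G i * H (n ∸ j ∸ i)))
      ∎
    where
    open ≈-Reasoning setoid
    reindex : ∀ j i → F j * G (j ℕ.+ i ∸ j) * H (n ∸ (j ℕ.+ i)) ≈ F j * (G i * H (n ∸ j ∸ i))
    reindex j i = trans (*-assoc _ _ _) (*-congˡ (*-cong
      (reflexive (P.cong G (ℕP.m+n∸m≡n j i)))
      (reflexive (P.cong H (P.sym (ℕP.∸-+-assoc n j i))))))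

  ·ₛ-swapʳ : ∀ F G H → (F ·ₛ G) ·ₛ H ≈ₛ (F ·ₛ H) ·ₛ G
  ·ₛ-swapʳ F G H = begin
    (F ·ₛ G) ·ₛ H  ≈⟨ ·ₛ-assoc F G H ⟩
    F ·ₛ (G ·ₛ H)  ≈⟨ ·ₛ-cong ≈ₛ.refl (·ₛ-comm G H) ⟩
    F ·ₛ (H ·ₛ G)  ≈⟨ ·ₛ-assoc F H G ⟨
    (F ·ₛ H) ·ₛ G  ∎
    where open ≈-Reasoning ≈ₛ-setoid

  ∙ₛ-·ₛ-assoc : ∀ x F G → (x ∙ₛ F) ·ₛ G ≈ₛ x ∙ₛ (F ·ₛ G)
  ∙ₛ-·ₛ-assoc x F G n =
    trans (sumTo-cong n (λ k _ → *-assoc _ _ _)) (sym (*-distribˡ-sumTo n x _))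

  ·ₛ-distribʳ-sum1ₛ : ∀ m (F : ℕ → FPS) G → sum1ₛ m F ·ₛ G ≈ₛ sum1ₛ m (λ a → F a ·ₛ G)
  ·ₛ-distribʳ-sum1ₛ m F G n =
    trans (sumTo-cong n (λ k _ → *-distribʳ-sum1 m _ _))
          (sumTo-sum1-comm n m (λ a k → F a k * G (n ∸ k)))

  dilate : Carrier → FPS → FPS
  dilate x F n = pow x n * F n

  dilate-·ₛ : ∀ x F G → dilate x (F ·ₛ G) ≈ₛ dilate x F ·ₛ dilate x G
  dilate-·ₛ x F G n =
    trans (*-distribˡ-sumTo n _ _) (sumTo-cong n (λ k k≤n → trans
      (*-congʳ (trans (reflexive (P.cong (pow x) (P.sym (ℕP.m+[n∸m]≡n k≤n))))
                      (pow-+ x k (n ∸ k))))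
      (*-Properties.interchange _ _ _ _)))

  module OverQ (Q : QAlgebra K) where
    open QAlgebra Q

    egf : (ℕ → Carrier) → FPS
    egf = D.egf K Q

    monoFact : ℕ → FPS
    monoFact = D.monoFact K Q

    expₛ : Carrier → FPS
    expₛ = D.expₛ K Q

    expTrunc : ℕ → Carrier → FPS
    expTrunc = D.expTrunc K Q

    ι!-inverse : ∀ n → ι (n !) * inv (n !) ≈ 1#
    ι!-inverse n = inv-correct (n !) (ℕ.≢-nonZero⁻¹ (n !) {{ℕP._!≢0 n}})

    ι-^-inverse : ∀ {m} n → 1 ≤ m → inv (m ^ n) * pow (ι m) n ≈ 1#
    ι-^-inverse {m} n 1≤m = trans (*-comm _ _) (trans (*-congʳ (sym (ι-^ m n)))
      (inv-correct (m ^ n) (ℕ.≢-nonZero⁻¹ (m ^ n) {{ℕP.m^n≢0 m n {{ℕ.>-nonZero 1≤m}}}})))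

    ι!-egf : ∀ b n → ι (n !) * egf b n ≈ b n
    ι!-egf b n = trans (*-Properties.x∙yz≈y∙xz _ _ _) (trans (*-congˡ (ι!-inverse n)) (*-identityʳ _))

    ι-binomial : ∀ {n k} → k ≤ n → ι (n !) * (inv (k !) * inv ((n ∸ k) !)) ≈ ι (n C k)
    ι-binomial {n} {k} k≤n = begin
      ι (n !) * (inv (k !) * inv ((n ∸ k) !))
        ≈⟨ *-congʳ ι[n!]≈ι[nCk]*ι[k!]*ι[[n∸k]!] ⟩
      (ι (n C k) * (ι (k !) * ι ((n ∸ k) !))) * (inv (k !) * inv ((n ∸ k) !))
        ≈⟨ *-assoc _ _ _ ⟩
      ι (n C k) * ((ι (k !) * ι ((n ∸ k) !)) * (inv (k !) * inv ((n ∸ k) !)))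
        ≈⟨ *-congˡ (*-Properties.interchange _ _ _ _) ⟩
      ι (n C k) * ((ι (k !) * inv (k !)) * (ι ((n ∸ k) !) * inv ((n ∸ k) !)))
        ≈⟨ *-congˡ (*-cong (ι!-inverse k) (ι!-inverse (n ∸ k))) ⟩
      ι (n C k) * (1# * 1#)
        ≈⟨ *-congˡ (*-identityˡ 1#) ⟩
      ι (n C k) * 1#
        ≈⟨ *-identityʳ _ ⟩
      ι (n C k)
        ∎
      where
      open ≈-Reasoning setoid
      ι[n!]≈ι[nCk]*ι[k!]*ι[[n∸k]!] : ι (n !) ≈ ι (n C k) * (ι (k !) * ι ((n ∸ k) !))
      ι[n!]≈ι[nCk]*ι[k!]*ι[[n∸k]!] =
        trans (reflexive (P.cong ι (P.sym (nCk*k!*[n∸k]!≡n! k≤n))))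
              (trans (ι-* (n C k) (k ! ℕ.* (n ∸ k) !)) (*-congˡ (ι-* (k !) ((n ∸ k) !))))

    monoFact-diag : ∀ N → monoFact N N ≈ inv (N !)
    monoFact-diag N =
      reflexive (P.cong (λ b → if b then inv (N !) else 0#) (dec-true (N ℕ.≟ N) P.refl))

    monoFact-off : ∀ N {n} → n ≢ N → monoFact N n ≈ 0#
    monoFact-off N {n} n≢N =
      reflexive (P.cong (λ b → if b then inv (N !) else 0#) (dec-false (n ℕ.≟ N) n≢N))

    dilate-expTrunc : ∀ N x → dilate x (expTrunc N 1#) ≈ₛ expTrunc N x
    dilate-expTrunc N x n with does (N ℕ.≤? n)
    ... | true  = *-congˡ (trans (*-congʳ (pow-1# n)) (*-identityˡ _))
    ... | false = zeroʳ _

    dilate-monoFact : ∀ N x → dilate x (monoFact N) ≈ₛ pow x N ∙ₛ monoFact N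
    dilate-monoFact N x n with n ℕ.≟ N
    ... | yes P.refl = refl
    ... | no n≢N     = trans (vanish n) (sym (vanish N))
      where
      vanish : ∀ m → pow x m * monoFact N n ≈ 0#
      vanish m = trans (*-congˡ (monoFact-off N n≢N)) (zeroʳ _)

    ·ₛ-monoFact-coefficient : ∀ N X y n →
      (X ·ₛ y ∙ₛ monoFact N) (n ℕ.+ N) ≈ X n * (y * inv (N !))
    ·ₛ-monoFact-coefficient N X y n =
      trans (sumTo-single (n ℕ.+ N) n (ℕP.m≤m+n n N) vanish)
            (*-congˡ (*-congˡ (trans (reflexive (P.cong (monoFact N) (ℕP.m+n∸m≡n n N)))
                                     (monoFact-diag N))))
      where
      vanish : ∀ k → k ≤ n ℕ.+ N → k ≢ n → X k * (y * monoFact N (n ℕ.+ N ∸ k)) ≈ 0#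
      vanish k k≤n+N k≢n =
        trans (*-congˡ (trans (*-congˡ (monoFact-off N n+N∸k≢N)) (zeroʳ y))) (zeroʳ _)
        where
        n+N∸k≢N : n ℕ.+ N ∸ k ≢ N
        n+N∸k≢N n+N∸k≡N = k≢n (ℕP.+-cancelˡ-≡ N k n (P.trans (P.sym (P.cong (ℕ._+ k) n+N∸k≡N))
                              (P.trans (ℕP.m∸n+n≡m k≤n+N) (ℕP.+-comm n N))))

    ·ₛ-cancelʳ-monoFact : ∀ N {y z X Y} → z * y ≈ 1# →
      X ·ₛ y ∙ₛ monoFact N ≈ₛ Y ·ₛ y ∙ₛ monoFact N → X ≈ₛ Y
    ·ₛ-cancelʳ-monoFact N {y} {z} {X} {Y} zy≈1 XM≈YM n =
      *-cancelʳ-invertible invertible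
        (trans (sym (·ₛ-monoFact-coefficient N X y n))
               (trans (XM≈YM (n ℕ.+ N)) (·ₛ-monoFact-coefficient N Y y n)))
      where
      open *-Solver using (solve; _⊕_; _⊜_)
      invertible : (y * inv (N !)) * (ι (N !) * z) ≈ 1#
      invertible = begin
        (y * inv (N !)) * (ι (N !) * z)
          ≈⟨ solve 4 (λ y i n z → ((y ⊕ i) ⊕ (n ⊕ z)) ⊜ ((z ⊕ y) ⊕ (n ⊕ i))) refl _ _ _ _ ⟩
        (z * y) * (ι (N !) * inv (N !))  ≈⟨ *-cong zy≈1 (ι!-inverse N) ⟩
        1# * 1#                          ≈⟨ *-identityˡ 1# ⟩
        1#                               ∎
        where open ≈-Reasoning setoid

    ·ₛ-cancelʳ : ∀ N {E s y z X Y} → s ·ₛ E ≈ₛ y ∙ₛ monoFact N → z * y ≈ 1# →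
                 X ·ₛ E ≈ₛ Y ·ₛ E → X ≈ₛ Y
    ·ₛ-cancelʳ N {E} {s} {y} {z} {X} {Y} sE≈yM zy≈1 XE≈YE =
      ·ₛ-cancelʳ-monoFact N zy≈1 (begin
        X ·ₛ y ∙ₛ monoFact N  ≈⟨ ·ₛ-cong ≈ₛ.refl (≈ₛ.trans (≈ₛ.sym sE≈yM) (·ₛ-comm s E)) ⟩
        X ·ₛ (E ·ₛ s)         ≈⟨ ·ₛ-assoc X E s ⟨
        (X ·ₛ E) ·ₛ s         ≈⟨ ·ₛ-cong XE≈YE (≈ₛ.refl {s}) ⟩
        (Y ·ₛ E) ·ₛ s         ≈⟨ ·ₛ-assoc Y E s ⟩
        Y ·ₛ (E ·ₛ s)         ≈⟨ ·ₛ-cong ≈ₛ.refl (≈ₛ.trans (·ₛ-comm E s) sE≈yM) ⟩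
        Y ·ₛ y ∙ₛ monoFact N  ∎)
      where open ≈-Reasoning ≈ₛ-setoid

    dilate-hypBernoulli : ∀ N {B} x → IsHypBernoulli K Q N B →
                          dilate x (egf B) ·ₛ expTrunc N x ≈ₛ pow x N ∙ₛ monoFact N
    dilate-hypBernoulli N {B} x isB = begin
      dilate x (egf B) ·ₛ expTrunc N x              ≈⟨ ·ₛ-cong ≈ₛ.refl (dilate-expTrunc N x) ⟨
      dilate x (egf B) ·ₛ dilate x (expTrunc N 1#)  ≈⟨ dilate-·ₛ x (egf B) (expTrunc N 1#) ⟨
      dilate x (egf B ·ₛ expTrunc N 1#)             ≈⟨ (λ n → *-congˡ (isB n)) ⟩
      dilate x (monoFact N)                         ≈⟨ dilate-monoFact N x ⟩
      pow x N ∙ₛ monoFact N                         ∎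
      where open ≈-Reasoning ≈ₛ-setoid

    twistedEgf : (ℤ → Carrier) → ℕ → ℕ → (ℕ → Carrier) → FPS
    twistedEgf χ f N B =
      sum1ₛ f (λ a → χ (+ a) ∙ₛ inv (f ^ N) ∙ₛ (dilate (ι f) (egf B) ·ₛ expₛ (ι a)))

    twistedEgf-·ₛ-expTrunc : ∀ χ {f} N {B} → 1 ≤ f → IsHypBernoulli K Q N B →
      twistedEgf χ f N B ·ₛ expTrunc N (ι f) ≈ₛ sum1ₛ f (λ a → χ (+ a) ∙ₛ (monoFact N ·ₛ expₛ (ι a)))
    twistedEgf-·ₛ-expTrunc χ {f} N {B} 1≤f isB =
      ≈ₛ.trans (·ₛ-distribʳ-sum1ₛ f _ E) (sum1ₛ-cong f (λ a →
        ≈ₛ.trans (∙ₛ-·ₛ-assoc (χ (+ a)) _ E) (∙ₛ-congˡ (χ (+ a)) (termwise a))))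
      where
      open ≈-Reasoning ≈ₛ-setoid
      s : FPS
      s = dilate (ι f) (egf B)
      E : FPS
      E = expTrunc N (ι f)
      ν : Carrier
      ν = inv (f ^ N)
      termwise : ∀ a → (ν ∙ₛ (s ·ₛ expₛ (ι a))) ·ₛ E ≈ₛ monoFact N ·ₛ expₛ (ι a)
      termwise a = begin
        (ν ∙ₛ (s ·ₛ expₛ (ι a))) ·ₛ E
          ≈⟨ ∙ₛ-·ₛ-assoc ν _ E ⟩
        ν ∙ₛ ((s ·ₛ expₛ (ι a)) ·ₛ E)
          ≈⟨ ∙ₛ-congˡ ν (·ₛ-swapʳ s (expₛ (ι a)) E) ⟩
        ν ∙ₛ ((s ·ₛ E) ·ₛ expₛ (ι a))
          ≈⟨ ∙ₛ-congˡ ν (·ₛ-cong (dilate-hypBernoulli N (ι f) isB) (≈ₛ.refl {expₛ (ι a)})) ⟩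
        ν ∙ₛ ((pow (ι f) N ∙ₛ monoFact N) ·ₛ expₛ (ι a))
          ≈⟨ ∙ₛ-congˡ ν (∙ₛ-·ₛ-assoc (pow (ι f) N) (monoFact N) (expₛ (ι a))) ⟩
        ν ∙ₛ pow (ι f) N ∙ₛ (monoFact N ·ₛ expₛ (ι a))
          ≈⟨ ∙ₛ-inverse _ (ι-^-inverse N 1≤f) ⟩
        monoFact N ·ₛ expₛ (ι a)
          ∎

    twistedEgf-coefficient : ∀ χ f N B n →
      ι (n !) * twistedEgf χ f N B n ≈
      sum1 f (λ a → χ (+ a) * sumTo n (λ k → ι (n C k) * B k * pow (ι a) (n ∸ k)
                                              * pow (ι f) k * inv (f ^ N)))
    twistedEgf-coefficient χ f N B n =
      trans (*-distribˡ-sum1 f _ _) (sum1-cong f (λ a →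
        trans (*-Properties.x∙yz≈y∙xz _ _ _) (*-congˡ
          (trans (*-congˡ (*-distribˡ-sumTo n ν _))
                 (trans (*-distribˡ-sumTo n _ _) (sumTo-cong n (term a)))))))
      where
      open *-Solver using (solve; _⊕_; _⊜_)
      ν : Carrier
      ν = inv (f ^ N)
      term : ∀ a k → k ≤ n →
        ι (n !) * (ν * ((pow (ι f) k * (B k * inv (k !))) * (pow (ι a) (n ∸ k) * inv ((n ∸ k) !))))
        ≈ ι (n C k) * B k * pow (ι a) (n ∸ k) * pow (ι f) k * ν
      term a k k≤n = trans
        (solve 7 (λ n! ν fᵏ b k! aⁿ⁻ᵏ [n∸k]! →
                   (n! ⊕ (ν ⊕ ((fᵏ ⊕ (b ⊕ k!)) ⊕ (aⁿ⁻ᵏ ⊕ [n∸k]!))))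
                ⊜ (((((n! ⊕ (k! ⊕ [n∸k]!)) ⊕ b) ⊕ aⁿ⁻ᵏ) ⊕ fᵏ) ⊕ ν)) refl _ _ _ _ _ _ _)
        (*-congʳ (*-congʳ (*-congʳ (*-congʳ (ι-binomial k≤n)))))

    generalizedHypBernoulli-explicit : ∀ χ {f N B Bχ} → 1 ≤ f →
      IsHypBernoulli K Q N B → IsGenHypBernoulli K Q N χ f Bχ → ∀ n →
      Bχ n ≈ sum1 f (λ a → χ (+ a) * sumTo n (λ k → ι (n C k) * B k * pow (ι a) (n ∸ k)
                                                      * pow (ι f) k * inv (f ^ N)))
    generalizedHypBernoulli-explicit χ {f} {N} {B} {Bχ} 1≤f isB isBχ n = begin
      Bχ n                            ≈⟨ ι!-egf Bχ n ⟨
      ι (n !) * egf Bχ n              ≈⟨ *-congˡ (egf≈twistedEgf n) ⟩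
      ι (n !) * twistedEgf χ f N B n  ≈⟨ twistedEgf-coefficient χ f N B n ⟩
      _                               ∎
      where
      open ≈-Reasoning setoid
      egf≈twistedEgf : egf Bχ ≈ₛ twistedEgf χ f N B
      egf≈twistedEgf =
        ·ₛ-cancelʳ N {E = expTrunc N (ι f)} (dilate-hypBernoulli N (ι f) isB) (ι-^-inverse N 1≤f)
          (≈ₛ.trans isBχ (≈ₛ.sym (twistedEgf-·ₛ-expTrunc χ N 1≤f isB)))

open D using (ι; pow; sumTo; sum1)

corollary2p3 : ∀ {c ℓ} (K : CommutativeRing c ℓ) (Q : QAlgebra K) →
    let open CommutativeRing K in
    (χ : ℤ → Carrier) (f : ℕ) → HasConductor K χ f →
    (N : ℕ) → 1 ≤ N →
    (B : ℕ → Carrier) → IsHypBernoulli K Q N B →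
    (Bχ : ℕ → Carrier) → IsGenHypBernoulli K Q N χ f Bχ →
    (n : ℕ) →
    Bχ n ≈ sum1 K f (λ a → χ (+ a) *
             sumTo K n (λ k → ι K (n C k) * B k * pow K (ι K a) (n ∸ k)
                               * pow K (ι K f) k * QAlgebra.inv Q (f ^ N)))
corollary2p3 K Q χ f conductor N _ B isB Bχ isBχ =
  PowerSeries.OverQ.generalizedHypBernoulli-explicit K Q χ (HasConductor.f-pos conductor) isB isBχ
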